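{- Let $n\ge1$, $x,y$ coprime with $1\le x<y$, and consider the rotor multigraph $P^{x,y}_n$. For rotor configurations $\rho,\rho'$, we have $\rho\sim\rho'$ if and only if $g(\rho)=g(\rho')$.
   Context: $P^{x,y}_n$ has vertices $u_0,\dots,u_{n+1}$; $u_0,u_{n+1}$ are sinks and $V_0=\{u_1,\dots,u_n\}$. For $1\le k\le n$, $u_k$ has outgoing arcs $a^k_0,\dots,a^k_{x+y-1}$, with $a^k_i$ going to $u_{k+1}$ for $0\le i\le x-1$ and to $u_{k-1}$ for $x\le i\le x+y-1$; rotor order $\theta(a^k_i)=a^k_{(i+1)\bmod(x+y)}$. A rotor configuration assigns to each $u\in V_0$ an outgoing arc $\rho(u)$; a particle configuration is a map $\sigma:\{u_0,\dots,u_{n+1}\}\to\mathbb{Z}$ (vertex $u$ identified with the configuration with one particle on $u$). For $u\in V_0$, $\mathrm{routing}^+_u(\rho,\sigma)=(\rho',\sigma+\mathrm{head}(\rho(u))-u)$ with $\rho'$ equal to $\rho$ except $\rho'(u)=\theta(\rho(u))$; these are commuting bijections; for $r:V_0\to\mathbb{Z}$, $\mathrm{routing}^r$ composes the $(\mathrm{routing}^+_u)^{r(u)}$ (negative powers = inverses); $(\rho,\sigma)\sim(\rho',\sigma')$ iff $\mathrm{routing}^r(\rho,\sigma)=(\rho',\sigma')$ for some $r$; and $\rho\sim\rho'$ iff $(\rho,\sigma)\sim(\rho',\sigma)$ for some $\sigma$. With $h(u_0)=0$, $h(u_k)=\sum_{i=0}^{k-1}x^{n-i}y^i$, define $g(a^k_j)=\sum_{i=0}^{j-1}\big(h(\mathrm{head}(a^k_i))-h(u_k)\big)$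 and $g(\rho)=\sum_{u\in V_0}g(\rho(u))$. -}

module Defs where

open import Data.Nat as ℕ using (ℕ; zero; suc; _∸_; _^_; _<ᵇ_)
open import Data.Nat.DivMod using (_mod_)
open import Data.Integer as ℤ using (ℤ; +_; -[1+_]; _+_; _-_; -_)
open import Data.Fin using (Fin; toℕ; inject₁) renaming (suc to fsuc; zero to fzero)
open import Data.Vec using (Vec; lookup; updateAt)
open import Data.List using (List; []; _∷_; map; foldr; allFin; upTo)
open import Data.Bool using (if_then_else_)
open import Data.Product using (_×_; _,_; Σ; ∃)
open import Relation.Binary.PropositionalEquality using (_≡_)

-- Vertices u_0,…,u_{n+1} are  Fin (2 + n)  (u_j ↦ j).
-- Non-sink vertices V_0 = {u_1,…,u_n} are indexed by  k : Fin n  (k ↦ u_{k+1}).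
-- The outgoing arcs a^{k+1}_0,…,a^{k+1}_{x+y-1} of a non-sink vertex are  Fin (x + y).

Vertex : ℕ → Set
Vertex n = Fin (suc (suc n))

vert : ∀ {n} → Fin n → Vertex n
vert k = fsuc (inject₁ k)

headℕ : ∀ {n} (x : ℕ) → Fin n → ℕ → Vertex n
headℕ x k i = if i <ᵇ x then fsuc (fsuc k) else inject₁ (inject₁ k)

head : ∀ {n} (x y : ℕ) → Fin n → Fin (x ℕ.+ y) → Vertex n
head x y k i = headℕ x k (toℕ i)

θ : ∀ {m} → Fin m → Fin m
θ {suc m} i = suc (toℕ i) mod (suc m)

θ⁻¹ : ∀ {m} → Fin m → Fin m
θ⁻¹ {suc m} i = (toℕ i ℕ.+ m) mod (suc m)

Rotor : (n x y : ℕ) → Set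
Rotor n x y = Vec (Fin (x ℕ.+ y)) n

Particles : ℕ → Set
Particles n = Vec ℤ (suc (suc n))

Config : (n x y : ℕ) → Set
Config n x y = Rotor n x y × Particles n

addAt : ∀ {n} → Particles n → Vertex n → ℤ → Particles n
addAt σ v z = updateAt σ v (λ a → a + z)

routing⁺ : ∀ {n} (x y : ℕ) → Fin n → Config n x y → Config n x y
routing⁺ x y k (ρ , σ) =
  ( updateAt ρ k θ
  , addAt (addAt σ (head x y k (lookup ρ k)) (+ 1)) (vert k) (- (+ 1)) )

routing⁻ : ∀ {n} (x y : ℕ) → Fin n → Config n x y → Config n x y
routing⁻ x y k (ρ , σ) =
  ( updateAt ρ k θ⁻¹
  , addAt (addAt σ (head x y k (θ⁻¹ (lookup ρ k))) (- (+ 1))) (vert k) (+ 1) )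

applyN : ∀ {A : Set} → ℕ → (A → A) → A → A
applyN zero    f a = a
applyN (suc m) f a = f (applyN m f a)

routingPow : ∀ {n} (x y : ℕ) → Fin n → ℤ → Config n x y → Config n x y
routingPow x y k (+ m)     = applyN m (routing⁺ x y k)
routingPow x y k -[1+ m ]  = applyN (suc m) (routing⁻ x y k)

routing : ∀ {n} (x y : ℕ) → (Fin n → ℤ) → Config n x y → Config n x y
routing {n} x y r c = foldr (λ k c' → routingPow x y k (r k) c') c (allFin n)

ConfigEquiv : ∀ {n} (x y : ℕ) → Config n x y → Config n x y → Set
ConfigEquiv {n} x y c c' = ∃ λ (r : Fin n → ℤ) → routing x y r c ≡ c'

RotorEquiv : ∀ {n} (x y : ℕ) → Rotor n x y → Rotor n x y → Set
RotorEquiv {n} x y ρ ρ' = ∃ λ (σ : Particles n) → ConfigEquiv x y (ρ , σ) (ρ' , σ)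

sumℤ : List ℤ → ℤ
sumℤ = foldr _+_ (+ 0)

sumℕ : List ℕ → ℕ
sumℕ = foldr ℕ._+_ 0

h : ∀ (n x y : ℕ) → Vertex n → ℤ
h n x y v = + sumℕ (map (λ i → x ^ (n ∸ i) ℕ.* y ^ i) (upTo (toℕ v)))

gArc : ∀ {n} (x y : ℕ) → Fin n → Fin (x ℕ.+ y) → ℤ
gArc {n} x y k j =
  sumℤ (map (λ i → h n x y (headℕ x k i) - h n x y (vert k)) (upTo (toℕ j)))

g : ∀ {n} (x y : ℕ) → Rotor n x y → ℤ
g {n} x y ρ = sumℤ (map (λ k → gArc x y k (lookup ρ k)) (allFin n))

-- Give u_{k+1} the weight w_k = x^(n-1-k) y^k. Then h(u_{k+2}) - h(u_{k+1}) = y w_k and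
-- h(u_k) - h(u_{k+1}) = -x w_k, so g(ρ) = Σ_k w_k φ(ρ(u_{k+1})), where φ(j) adds y for every
-- forward and -x for every backward arc among the first j; in particular φ(x+y) = 0.
--
-- (⇒) A routing step at u changes g by h(head) - h(u), which is also the change of Σ_v h(v) σ(v).
-- Hence g(ρ) - Σ h σ is invariant under routing, and routing that returns to σ preserves g.
--
-- (⇐) Routing a rotor t times with F forward and t - F backward moves changes φ by
-- yF - x(t - F). As φ(j) ≡ -xj modulo x + y and gcd(x, x + y) = 1, that value determines both
-- the final arc and F. If g(ρ) = g(ρ'), then Σ_k w_k (φ(ρ'_k) - φ(ρ_k)) = 0, and coprimality of x
-- and y gives integers e_0 = 0, e_1, …, e_n = 0 with y e_{k+1} - x e_k = φ(ρ'_k) - φ(ρ_k).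
-- Routing u_{k+1} exactly e_{k+1} + e_k times then ends at ρ'_k and sends e_{k+1} particles
-- forward and e_k backward: e_j particles cross each edge u_j u_{j+1} in each direction, so
-- every vertex keeps its particles.

module Submission where

open import Defs
open import Data.Nat using (ℕ; _≤_; _<_)
open import Data.Nat.Coprimality using (Coprime)
open import Data.Integer using (ℤ)
open import Function.Bundles using (_⇔_)
open import Relation.Binary.PropositionalEquality using (_≡_)

open import Data.Nat as ℕ using (zero; suc; _∸_; _^_; _<ᵇ_; z≤n; s≤s)
import Data.Nat.Properties as ℕ
open import Data.Nat.DivMod using (_%_; m<n⇒m%n≡m; n%n≡0; [m+n]%n≡m%n; %-distribˡ-+; m%n%n≡m%n)
open import Data.Integer as ℤ using (+_; -[1+_]; -_; _+_; _-_; _*_; 0ℤ; 1ℤ)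
import Data.Integer.Properties as ℤ
open import Algebra.Properties.AbelianGroup ℤ.+-0-abelianGroup using (∙-cancelʳ)
open import Data.Integer.Divisibility using () renaming (_∣_ to _∣ᵤ_)
import Data.Integer.Divisibility.Signed as ℤ∣
import Data.Integer.Coprimality as ℤCop
import Data.Nat.Divisibility as ℕ∣
import Data.Nat.Coprimality as ℕCop
open import Data.Integer.Tactic.RingSolver using (solve-∀)
open import Data.Fin as Fin using (Fin; toℕ; inject₁) renaming (zero to fzero; suc to fsuc)
import Data.Fin.Properties as Fin
open import Data.List using (List; []; _∷_; map; foldr; tabulate; allFin; upTo; applyUpTo)
import Data.List.Properties as List
import Data.List.Relation.Unary.All as All
open import Data.List.Relation.Unary.AllPairs using ([]; _∷_)
open import Data.List.Relation.Unary.Unique.Propositional using (Unique)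
open import Data.List.Relation.Unary.Unique.Propositional.Properties using (allFin⁺)
open import Data.List.Membership.Propositional.Properties using (∈-allFin)
open import Data.List.Membership.Propositional using (_∈_; _∉_)
open import Data.List.Relation.Unary.All.Properties using (All¬⇒¬Any)
open import Data.List.Relation.Unary.Any using (here; there)
open import Data.Product using (_×_; _,_; proj₁; proj₂; Σ)
open import Data.Sum using (_⊎_; inj₁; inj₂)
open import Function using (_∘_; id)
open import Function.Bundles using (Equivalence; mk⇔)
open import Data.Vec using (lookup; updateAt; replicate)
import Data.Vec.Properties as Vec
open import Data.Vec.Relation.Binary.Pointwise.Extensional using (ext; Pointwise-≡⇒≡)
open import Data.Bool using (T; true; false; if_then_else_)
open import Data.Bool.Properties using (T-≡)
open import Data.Empty using (⊥-elim)
open import Relation.Nullary using (yes; no; does)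
open import Relation.Nullary.Decidable using (dec-true; dec-false)
open import Relation.Binary.PropositionalEquality using (refl; sym; trans; cong; cong₂; subst; _≢_; module ≡-Reasoning)

applyN-invariant : {A : Set} (P : ℕ → A → Set) (f : A → A) {a : A} →
                   P 0 a → (∀ {i b} → P i b → P (suc i) (f b)) → ∀ s → P s (applyN s f a)
applyN-invariant P f p₀ step zero    = p₀
applyN-invariant P f p₀ step (suc s) = step (applyN-invariant P f p₀ step s)

sumℤ-update : {A : Set} {xs : List A} {k : A} → Unique xs → k ∈ xs → (f f′ : A → ℤ) →
              (∀ j → j ≢ k → f′ j ≡ f j) → sumℤ (map f′ xs) ≡ sumℤ (map f xs) + (f′ k - f k)
sumℤ-update {k = k} (k∉xs ∷ _) (here refl) f f′ off =
  trans (cong (λ s → f′ k + s) (cong sumℤ (List.map-cong-local (All.map (λ k≢j → off _ (k≢j ∘ sym)) k∉xs))))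
        (shift (f′ k) (f k) _)
  where shift : ∀ a b s → a + s ≡ (b + s) + (a - b)
        shift = solve-∀
sumℤ-update {xs = j ∷ _} (j∉xs ∷ uniq) (there k∈xs) f f′ off =
  trans (cong₂ _+_ (off j (All.lookup j∉xs k∈xs)) (sumℤ-update uniq k∈xs f f′ off))
        (sym (ℤ.+-assoc (f j) _ _))

sumℤ-telescope : ∀ p (a : ℕ → ℤ) →
                 sumℤ (map (λ (k : Fin p) → a (suc (toℕ k)) - a (toℕ k)) (allFin p)) ≡ a p - a 0
sumℤ-telescope p a = trans (cong sumℤ (List.map-tabulate {n = p} id (λ k → a (suc (toℕ k)) - a (toℕ k)))) (telescope p a)
  where
  telescope : ∀ p (a : ℕ → ℤ) → sumℤ (tabulate (λ (k : Fin p) → a (suc (toℕ k)) - a (toℕ k))) ≡ a p - a 0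
  telescope zero    a = sym (ℤ.+-inverseʳ (a 0))
  telescope (suc p) a = trans (cong (λ s → (a 1 - a 0) + s) (telescope p (a ∘ suc))) (chain (a 0) (a 1) (a (suc p)))
    where chain : ∀ a₀ a₁ aₚ → (a₁ - a₀) + (aₚ - a₁) ≡ aₚ - a₀
          chain = solve-∀

sumℤ-scale : ∀ c (xs : List ℤ) → c * sumℤ xs ≡ sumℤ (map (c *_) xs)
sumℤ-scale c []       = ℤ.*-zeroʳ c
sumℤ-scale c (z ∷ xs) = trans (ℤ.*-distribˡ-+ c z _) (cong (_+_ (c * z)) (sumℤ-scale c xs))

sumℕ-upTo-suc : ∀ (f : ℕ → ℕ) t → sumℕ (map f (upTo (suc t))) ≡ sumℕ (map f (upTo t)) ℕ.+ f t
sumℕ-upTo-suc f = go id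
  where
  go : ∀ g t → sumℕ (map f (applyUpTo g (suc t))) ≡ sumℕ (map f (applyUpTo g t)) ℕ.+ f (g t)
  go g zero    = ℕ.+-identityʳ (f (g 0))
  go g (suc t) = trans (cong (f (g 0) ℕ.+_) (go (g ∘ suc) t)) (sym (ℕ.+-assoc (f (g 0)) _ _))

sumℤ-upTo-suc : ∀ (f : ℕ → ℤ) t → sumℤ (map f (upTo (suc t))) ≡ sumℤ (map f (upTo t)) + f t
sumℤ-upTo-suc f = go id
  where
  go : ∀ g t → sumℤ (map f (applyUpTo g (suc t))) ≡ sumℤ (map f (applyUpTo g t)) + f (g t)
  go g zero    = trans (ℤ.+-identityʳ (f (g 0))) (sym (ℤ.+-identityˡ (f (g 0))))
  go g (suc t) = trans (cong (_+_ (f (g 0))) (go (g ∘ suc) t)) (sym (ℤ.+-assoc (f (g 0)) _ _))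

-- Linear recurrences with coprime coefficients

module _ (x y : ℕ) where

  weightedSum : ∀ p → (Fin p → ℤ) → ℤ
  weightedSum zero    a = 0ℤ
  weightedSum (suc p) a = + (x ^ p) * a fzero + + y * weightedSum p (a ∘ fsuc)

  weightedSum-as-sum : ∀ p (a : Fin p → ℤ) →
    weightedSum p a ≡ sumℤ (map (λ k → + (x ^ (p ∸ suc (toℕ k)) ℕ.* y ^ toℕ k) * a k) (allFin p))
  weightedSum-as-sum p a = trans (expand p a) (sym (cong sumℤ (List.map-tabulate {n = p} id (weighted p a))))
    where
    weighted : ∀ p → (Fin p → ℤ) → Fin p → ℤ
    weighted p a k = + (x ^ (p ∸ suc (toℕ k)) ℕ.* y ^ toℕ k) * a k
    expand : ∀ p (a : Fin p → ℤ) → weightedSum p a ≡ sumℤ (tabulate (weighted p a))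
    expand zero    a = refl
    expand (suc p) a = cong₂ _+_ (cong (_* a fzero) (cong +_ (sym (ℕ.*-identityʳ (x ^ p))))) (begin
      + y * weightedSum p (a ∘ fsuc)
        ≡⟨ cong (+ y *_) (expand p (a ∘ fsuc)) ⟩
      + y * sumℤ (tabulate (weighted p (a ∘ fsuc)))
        ≡⟨ sumℤ-scale (+ y) (tabulate (weighted p (a ∘ fsuc))) ⟩
      sumℤ (map (+ y *_) (tabulate (weighted p (a ∘ fsuc))))
        ≡⟨ cong sumℤ (List.map-tabulate (weighted p (a ∘ fsuc)) (+ y *_)) ⟩
      sumℤ (tabulate (λ k → + y * weighted p (a ∘ fsuc) k))
        ≡⟨ cong sumℤ (List.tabulate-cong (λ k → shift-y (x ^ (p ∸ suc (toℕ k))) (y ^ toℕ k) (a (fsuc k)))) ⟩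
      sumℤ (tabulate (weighted (suc p) a ∘ fsuc)) ∎)
      where
      open ≡-Reasoning
      shift-y : ∀ u v c → + y * (+ (u ℕ.* v) * c) ≡ + (u ℕ.* (y ℕ.* v)) * c
      shift-y u v c = begin
        + y * (+ (u ℕ.* v) * c)     ≡⟨ cong (λ t → + y * (t * c)) (ℤ.pos-* u v) ⟩
        + y * (+ u * + v * c)       ≡⟨ ring (+ y) (+ u) (+ v) c ⟩
        + u * (+ y * + v) * c       ≡⟨ cong (λ t → + u * t * c) (ℤ.pos-* y v) ⟨
        + u * + (y ℕ.* v) * c       ≡⟨ cong (_* c) (ℤ.pos-* u (y ℕ.* v)) ⟨
        + (u ℕ.* (y ℕ.* v)) * c     ∎
        where ring : ∀ y u v c → y * (u * v * c) ≡ u * (y * v) * c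
              ring = solve-∀

  weightedSum-sub : ∀ p (a b : Fin p → ℤ) →
                    weightedSum p (λ k → a k - b k) ≡ weightedSum p a - weightedSum p b
  weightedSum-sub zero    a b = refl
  weightedSum-sub (suc p) a b =
    trans (cong (λ s → + (x ^ p) * (a fzero - b fzero) + + y * s) (weightedSum-sub p (a ∘ fsuc) (b ∘ fsuc)))
          (ring (+ (x ^ p)) (+ y) (a fzero) (b fzero) _ _)
    where ring : ∀ X Y a b s t → X * (a - b) + Y * (s - t) ≡ (X * a + Y * s) - (X * b + Y * t)
          ring = solve-∀

coprime-divisor-^ : ∀ {x y} → Coprime y x → ∀ p z → + y ∣ᵤ + (x ^ p) * z → + y ∣ᵤ z
coprime-divisor-^ {y = y} cop zero    z y∣z = subst (+ y ∣ᵤ_) (ℤ.*-identityˡ z) y∣z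
coprime-divisor-^ {x} {y} cop (suc p) z y∣xz = coprime-divisor-^ cop p z
  (ℤCop.coprime-divisor (+ y) (+ x) _ cop (subst (+ y ∣ᵤ_) regroup y∣xz))
  where regroup : + (x ℕ.* x ^ p) * z ≡ + x * (+ (x ^ p) * z)
        regroup = trans (cong (_* z) (ℤ.pos-* x (x ^ p))) (ℤ.*-assoc (+ x) _ z)

residue-injective : ∀ {m x a b} → Coprime m x → a < m → b < m → + m ∣ᵤ + x * (+ a - + b) → a ≡ b
residue-injective {m} {x} {a} {b} cop a<m b<m m∣x[a-b] =
  ℤ.+-injective (ℤ.i-j≡0⇒i≡j _ _ (ℤ.∣i∣≡0⇒i≡0 ∣a-b∣≡0))
  where
  instance
    m-nonZero : ℕ.NonZero m
    m-nonZero = ℕ.>-nonZero (ℕ.≤-<-trans z≤n a<m)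
  ∣a-b∣<m : ℤ.∣ + a - + b ∣ < m
  ∣a-b∣<m = subst (_< m) (cong ℤ.∣_∣ (sym (ℤ.m-n≡m⊖n a b)))
                  (ℕ.≤-<-trans (ℤ.∣m⊝n∣≤m⊔n a b) (ℕ.⊔-lub a<m b<m))
  ∣a-b∣≡0 : ℤ.∣ + a - + b ∣ ≡ 0
  ∣a-b∣≡0 = trans (sym (m<n⇒m%n≡m ∣a-b∣<m))
                  (ℕ∣.n∣m⇒m%n≡0 _ m (ℤCop.coprime-divisor (+ m) (+ x) _ cop m∣x[a-b]))

RecurrenceSolution : (x y p : ℕ) → (Fin p → ℤ) → ℤ → Set
RecurrenceSolution x y p a e₀ =
  Σ (ℕ → ℤ) λ e → e 0 ≡ e₀ × e p ≡ 0ℤ × (∀ k → + y * e (suc (toℕ k)) - + x * e (toℕ k) ≡ a k)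

recurrence-prepend : ∀ {x y p a e₀} e₁ → + y * e₁ - + x * e₀ ≡ a fzero →
                     RecurrenceSolution x y p (a ∘ fsuc) e₁ → RecurrenceSolution x y (suc p) a e₀
recurrence-prepend {x} {y} {p} {a} {e₀} e₁ first (e , e0≡e₁ , ep≡0 , rest) = e′ , refl , ep≡0 , recurrence
  where
  e′ : ℕ → ℤ
  e′ zero    = e₀
  e′ (suc j) = e j
  recurrence : ∀ k → + y * e′ (suc (toℕ k)) - + x * e′ (toℕ k) ≡ a k
  recurrence fzero    = trans (cong (λ t → + y * t - + x * e₀) e0≡e₁) first
  recurrence (fsuc k) = rest k

-- With W the weighted sum of the tail, x^p (x e₀ + a₀) = -y W; so y divides x e₀ + a₀,
-- and the quotient is the next term.
recurrence-next-term : ∀ {x y} .{{_ : ℕ.NonZero y}} → Coprime x y → ∀ p (a : Fin (suc p) → ℤ) e₀ →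
  + (x ^ suc p) * e₀ + weightedSum x y (suc p) a ≡ 0ℤ →
  Σ ℤ λ e₁ → + y * e₁ - + x * e₀ ≡ a fzero × + (x ^ p) * e₁ + weightedSum x y p (a ∘ fsuc) ≡ 0ℤ
recurrence-next-term {x} {y} cop p a e₀ eq = q , first , rest
  where
  open ≡-Reasoning
  X W z : ℤ
  X = + (x ^ p)
  W = weightedSum x y p (a ∘ fsuc)
  z = + x * e₀ + a fzero
  Xz≡-yW : X * z ≡ - (+ y * W)
  Xz≡-yW = begin
    X * z                                      ≡⟨ ring₁ (+ x) X e₀ (a fzero) (+ y * W) ⟩
    (+ x * X) * e₀ + (X * a fzero + + y * W) - + y * W
                                               ≡⟨ cong (λ t → t * e₀ + (X * a fzero + + y * W) - + y * W) (ℤ.pos-* x (x ^ p)) ⟨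
    + (x ^ suc p) * e₀ + (X * a fzero + + y * W) - + y * W
                                               ≡⟨ cong (_- + y * W) eq ⟩
    0ℤ - + y * W                               ≡⟨ ℤ.+-identityˡ _ ⟩
    - (+ y * W)                                ∎
    where ring₁ : ∀ x X e a s → X * (x * e + a) ≡ (x * X) * e + (X * a + s) - s
          ring₁ = solve-∀
  y∣z : + y ℤ∣.∣ z
  y∣z = ℤ∣.∣ᵤ⇒∣ (coprime-divisor-^ (ℕCop.sym cop) p z
          (ℤ∣.∣⇒∣ᵤ (ℤ∣.divides (- W) (trans Xz≡-yW (ring₂ (+ y) W)))))
    where ring₂ : ∀ y W → - (y * W) ≡ - W * y
          ring₂ = solve-∀
  q : ℤ
  q = ℤ∣.quotient y∣z
  first : + y * q - + x * e₀ ≡ a fzero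
  first = begin
    + y * q - + x * e₀     ≡⟨ cong (_- + x * e₀) (trans (ℤ.*-comm (+ y) q) (sym (ℤ∣._∣_.equality y∣z))) ⟩
    z - + x * e₀           ≡⟨ ring₃ (+ x * e₀) (a fzero) ⟩
    a fzero                ∎
    where ring₃ : ∀ u a → (u + a) - u ≡ a
          ring₃ = solve-∀
  rest : X * q + W ≡ 0ℤ
  rest = ℤ.*-cancelˡ-≡ (+ y) _ 0ℤ (begin
    + y * (X * q + W)       ≡⟨ ring₄ (+ y) X q W ⟩
    X * (q * + y) + + y * W ≡⟨ cong (λ t → X * t + + y * W) (ℤ∣._∣_.equality y∣z) ⟨
    X * z + + y * W         ≡⟨ cong (_+ + y * W) Xz≡-yW ⟩
    - (+ y * W) + + y * W   ≡⟨ ℤ.+-inverseˡ (+ y * W) ⟩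
    0ℤ                      ≡⟨ ℤ.*-zeroʳ (+ y) ⟨
    + y * 0ℤ                ∎)
    where ring₄ : ∀ y X q W → y * (X * q + W) ≡ X * (q * y) + y * W
          ring₄ = solve-∀

solve-recurrence : ∀ {x y} .{{_ : ℕ.NonZero y}} → Coprime x y → ∀ p (a : Fin p → ℤ) e₀ →
  + (x ^ p) * e₀ + weightedSum x y p a ≡ 0ℤ → RecurrenceSolution x y p a e₀
solve-recurrence cop zero a e₀ eq =
  (λ _ → e₀) , refl , trans (sym (ℤ.*-identityˡ e₀)) (trans (sym (ℤ.+-identityʳ _)) eq) , λ ()
solve-recurrence {x} {y} cop (suc p) a e₀ eq =
  let (e₁ , first , rest) = recurrence-next-term cop p a e₀ eq
  in recurrence-prepend {x} {y} e₁ first (solve-recurrence cop p (a ∘ fsuc) e₁ rest)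

module _ {M : ℕ} where

  toℕ-θ : (i : Fin (suc M)) → toℕ (θ i) ≡ suc (toℕ i) % suc M
  toℕ-θ i = Fin.toℕ-fromℕ< _

  toℕ-θ-cases : (i : Fin (suc M)) → toℕ (θ i) ≡ suc (toℕ i) ⊎ (toℕ (θ i) ≡ 0 × toℕ i ≡ M)
  toℕ-θ-cases i with ℕ.m≤n⇒m<n∨m≡n (ℕ.s≤s⁻¹ (Fin.toℕ<n i))
  ... | inj₁ i<M  = inj₁ (trans (toℕ-θ i) (m<n⇒m%n≡m (s≤s i<M)))
  ... | inj₂ i≡M  = inj₂ (trans (toℕ-θ i) (trans (cong (λ t → suc t % suc M) i≡M) (n%n≡0 (suc M))) , i≡M)

  θ∘θ⁻¹ : (i : Fin (suc M)) → θ (θ⁻¹ i) ≡ i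
  θ∘θ⁻¹ i = Fin.toℕ-injective (begin
    toℕ (θ (θ⁻¹ i))                       ≡⟨ toℕ-θ (θ⁻¹ i) ⟩
    suc (toℕ (θ⁻¹ i)) % N                 ≡⟨ cong (λ t → suc t % N) (Fin.toℕ-fromℕ< _) ⟩
    (1 ℕ.+ (toℕ i ℕ.+ M) % N) % N         ≡⟨ %-distribˡ-+ 1 ((toℕ i ℕ.+ M) % N) N ⟩
    (1 % N ℕ.+ (toℕ i ℕ.+ M) % N % N) % N ≡⟨ cong (λ t → (1 % N ℕ.+ t) % N) (m%n%n≡m%n (toℕ i ℕ.+ M) N) ⟩
    (1 % N ℕ.+ (toℕ i ℕ.+ M) % N) % N     ≡⟨ %-distribˡ-+ 1 (toℕ i ℕ.+ M) N ⟨
    (1 ℕ.+ (toℕ i ℕ.+ M)) % N             ≡⟨ cong (_% N) (sym (ℕ.+-suc (toℕ i) M)) ⟩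
    (toℕ i ℕ.+ N) % N                     ≡⟨ [m+n]%n≡m%n (toℕ i) N ⟩
    toℕ i % N                             ≡⟨ m<n⇒m%n≡m (Fin.toℕ<n i) ⟩
    toℕ i                                 ∎)
    where open ≡-Reasoning
          N : ℕ
          N = suc M

δ : ℕ → ℕ → ℤ
δ i j = if does (i ℕ.≟ j) then 1ℤ else 0ℤ

lookup-addAt : ∀ {n} (σ : Particles n) (v w : Vertex n) (z : ℤ) →
               lookup (addAt σ v z) w ≡ lookup σ w + z * δ (toℕ v) (toℕ w)
lookup-addAt σ v w z with v Fin.≟ w
... | yes refl = begin
  lookup (addAt σ v z) v                  ≡⟨ Vec.lookup∘updateAt v σ ⟩
  lookup σ v + z                          ≡⟨ cong (_+_ (lookup σ v)) (ℤ.*-identityʳ z) ⟨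
  lookup σ v + z * 1ℤ                     ≡⟨ cong (λ d → lookup σ v + z * (if d then 1ℤ else 0ℤ))
                                                  (dec-true (toℕ v ℕ.≟ toℕ v) refl) ⟨
  lookup σ v + z * δ (toℕ v) (toℕ v)      ∎
  where open ≡-Reasoning
... | no v≢w = begin
  lookup (addAt σ v z) w                  ≡⟨ Vec.lookup∘updateAt′ w v (v≢w ∘ sym) σ ⟩
  lookup σ w                              ≡⟨ ℤ.+-identityʳ (lookup σ w) ⟨
  lookup σ w + 0ℤ                         ≡⟨ cong (_+_ (lookup σ w)) (ℤ.*-zeroʳ z) ⟨
  lookup σ w + z * 0ℤ                     ≡⟨ cong (λ d → lookup σ w + z * (if d then 1ℤ else 0ℤ))
                                                  (dec-false (toℕ v ℕ.≟ toℕ w) (v≢w ∘ Fin.toℕ-injective)) ⟨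
  lookup σ w + z * δ (toℕ v) (toℕ w)      ∎
  where open ≡-Reasoning

-- u_{k+1} sends F particles to u_{k+2} and B particles to u_k.
transfer : ℕ → ℤ → ℤ → ℕ → ℤ
transfer k F B w = F * δ (2 ℕ.+ k) w + B * δ k w - (F + B) * δ (1 ℕ.+ k) w

transfer-+ : ∀ k F B F′ B′ w → transfer k F B w + transfer k F′ B′ w ≡ transfer k (F + F′) (B + B′) w
transfer-+ k F B F′ B′ w = ring F B F′ B′ (δ (2 ℕ.+ k) w) (δ k w) (δ (1 ℕ.+ k) w)
  where ring : ∀ F B F′ B′ d₂ d₀ d₁ → (F * d₂ + B * d₀ - (F + B) * d₁) + (F′ * d₂ + B′ * d₀ - (F′ + B′) * d₁) ≡
                                       (F + F′) * d₂ + (B + B′) * d₀ - ((F + F′) + (B + B′)) * d₁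
        ring = solve-∀

transfers-telescope : ∀ n (e : ℕ → ℤ) → e 0 ≡ 0ℤ → e n ≡ 0ℤ → ∀ w →
  sumℤ (map (λ (k : Fin n) → transfer (toℕ k) (e (suc (toℕ k))) (e (toℕ k)) w) (allFin n)) ≡ 0ℤ
transfers-telescope n e e₀≡0 eₙ≡0 w = begin
  sumℤ (map (λ k → transfer (toℕ k) (e (suc (toℕ k))) (e (toℕ k)) w) (allFin n))
    ≡⟨ cong sumℤ (List.map-cong (λ k → ring (e (suc (toℕ k))) (e (toℕ k)) (δ (2 ℕ.+ toℕ k) w) (δ (toℕ k) w) (δ (1 ℕ.+ toℕ k) w)) (allFin n)) ⟩
  sumℤ (map (λ k → flow (suc (toℕ k)) - flow (toℕ k)) (allFin n))
    ≡⟨ sumℤ-telescope n flow ⟩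
  e n * Δ n - e 0 * Δ 0
    ≡⟨ cong₂ (λ a b → a * Δ n - b * Δ 0) eₙ≡0 e₀≡0 ⟩
  0ℤ * Δ n - 0ℤ * Δ 0
    ≡⟨ ring′ (Δ n) (Δ 0) ⟩
  0ℤ ∎
  where
  open ≡-Reasoning
  Δ flow : ℕ → ℤ
  Δ j = δ (suc j) w - δ j w
  flow j = e j * Δ j
  ring : ∀ e₁ e₀ d₂ d₀ d₁ → e₁ * d₂ + e₀ * d₀ - (e₁ + e₀) * d₁ ≡ e₁ * (d₂ - d₁) - e₀ * (d₁ - d₀)
  ring = solve-∀
  ring′ : ∀ a b → 0ℤ * a - 0ℤ * b ≡ 0ℤ
  ring′ = solve-∀

-- A single rotor

module Arcs (x' y' : ℕ) where

  x y m : ℕ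
  x = suc x'
  y = suc y'
  m = x ℕ.+ y

  forward : ℕ → ℤ
  forward i = if i <ᵇ x then 1ℤ else 0ℤ

  arcStep : ℕ → ℤ
  arcStep i = + y * forward i - + x * (1ℤ - forward i)

  φ : ℕ → ℤ
  φ zero    = 0ℤ
  φ (suc j) = φ j + arcStep j

  arcStep-below : ∀ {i} → i < x → arcStep i ≡ + y
  arcStep-below {i} i<x rewrite Equivalence.to T-≡ (ℕ.<⇒<ᵇ i<x) = ring (+ y) (+ x)
    where ring : ∀ y x → y * 1ℤ - x * (1ℤ - 1ℤ) ≡ y
          ring = solve-∀

  arcStep-above : ∀ {i} → x ≤ i → arcStep i ≡ - + x
  arcStep-above {i} x≤i with i <ᵇ x in eq
  ... | true  = ⊥-elim (ℕ.<⇒≱ (ℕ.<ᵇ⇒< i x (subst T (sym eq) _)) x≤i)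
  ... | false = ring (+ y) (+ x)
    where ring : ∀ y x → y * 0ℤ - x * (1ℤ - 0ℤ) ≡ - x
          ring = solve-∀

  φ-congruence : ∀ j → Σ ℤ λ c → φ j ≡ + m * c - + x * + j
  φ-congruence zero    = 0ℤ , ring (+ m) (+ x)
    where ring : ∀ m x → 0ℤ ≡ m * 0ℤ - x * 0ℤ
          ring = solve-∀
  φ-congruence (suc j) with φ-congruence j
  ... | c , φj≡ = c + forward j , trans (cong (_+ arcStep j) φj≡) (ring (+ x) (+ y) c (+ j) (forward j))
    where ring : ∀ x y c j f → ((x + y) * c - x * j) + (y * f - x * (1ℤ - f)) ≡ (x + y) * (c + f) - x * (1ℤ + j)
          ring = solve-∀

  φ-below : ∀ j → j ≤ x → φ j ≡ + y * + j
  φ-below zero    _      = sym (ℤ.*-zeroʳ (+ y))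
  φ-below (suc j) j<x = trans (cong₂ _+_ (φ-below j (ℕ.<⇒≤ j<x)) (arcStep-below j<x)) (ring (+ y) (+ j))
    where ring : ∀ y j → y * j + y ≡ y * (1ℤ + j)
          ring = solve-∀

  φ-above : ∀ j → x ≤ j → φ j ≡ + x * (+ m - + j)
  φ-above (suc j) x≤1+j with ℕ.m≤n⇒m<n∨m≡n x≤1+j
  ... | inj₁ x<1+j = trans (cong₂ _+_ (φ-above j (ℕ.s≤s⁻¹ x<1+j)) (arcStep-above (ℕ.s≤s⁻¹ x<1+j)))
                           (ring (+ x) (+ m) (+ j))
    where ring : ∀ x m j → x * (m - j) + - x ≡ x * (m - (1ℤ + j))
          ring = solve-∀
  ... | inj₂ x≡1+j = subst (λ j → φ j ≡ + x * (+ m - + j)) x≡1+j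
                           (trans (φ-below x ℕ.≤-refl) (ring (+ x) (+ y)))
    where ring : ∀ x y → y * x ≡ x * ((x + y) - x)
          ring = solve-∀

  φ-cycle : φ m ≡ 0ℤ
  φ-cycle = trans (φ-above m (ℕ.m≤m+n x y)) (trans (cong (+ x *_) (ℤ.+-inverseʳ (+ m))) (ℤ.*-zeroʳ (+ x)))

  φ-θ : (b : Fin m) → φ (toℕ (θ b)) ≡ φ (suc (toℕ b))
  φ-θ b with toℕ-θ-cases b
  ... | inj₁ θb≡1+b       = cong φ θb≡1+b
  ... | inj₂ (θb≡0 , b≡M) = trans (cong φ θb≡0) (sym (trans (cong (φ ∘ suc) b≡M) φ-cycle))

  -- The current arc and the net number of forward moves so far.
  Walk : Set
  Walk = Fin m × ℤ

  advance retreat : Walk → Walk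
  advance (b , F) = θ b , F + forward (toℕ b)
  retreat (b , F) = θ⁻¹ b , F - forward (toℕ (θ⁻¹ b))

  walk : ℤ → Walk → Walk
  walk (+ s)     = applyN s advance
  walk -[1+ s ]  = applyN (suc s) retreat

  Balanced : Fin m → ℤ → Walk → Set
  Balanced a t w = + y * proj₂ w - + x * (t - proj₂ w) ≡ φ (toℕ (proj₁ w)) - φ (toℕ a)

  advance-balanced : ∀ {a t w} → Balanced a t w → Balanced a (1ℤ + t) (advance w)
  advance-balanced {a} {t} {b , F} bal = begin
    + y * (F + forward (toℕ b)) - + x * ((1ℤ + t) - (F + forward (toℕ b)))
      ≡⟨ ring (+ x) (+ y) t F (forward (toℕ b)) ⟩
    (+ y * F - + x * (t - F)) + arcStep (toℕ b)
      ≡⟨ cong (_+ arcStep (toℕ b)) bal ⟩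
    (φ (toℕ b) - φ (toℕ a)) + arcStep (toℕ b)
      ≡⟨ ring′ (φ (toℕ b)) (φ (toℕ a)) (arcStep (toℕ b)) ⟩
    φ (suc (toℕ b)) - φ (toℕ a)
      ≡⟨ cong (_- φ (toℕ a)) (φ-θ b) ⟨
    φ (toℕ (θ b)) - φ (toℕ a) ∎
    where
    open ≡-Reasoning
    ring : ∀ x y t F f → y * (F + f) - x * ((1ℤ + t) - (F + f)) ≡ (y * F - x * (t - F)) + (y * f - x * (1ℤ - f))
    ring = solve-∀
    ring′ : ∀ u v s → (u - v) + s ≡ (u + s) - v
    ring′ = solve-∀

  retreat-balanced : ∀ {a t w} → Balanced a (- t) w → Balanced a (- (1ℤ + t)) (retreat w)
  retreat-balanced {a} {t} {b , F} bal = begin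
    + y * (F - forward (toℕ c)) - + x * (- (1ℤ + t) - (F - forward (toℕ c)))
      ≡⟨ ring (+ x) (+ y) t F (forward (toℕ c)) ⟩
    (+ y * F - + x * (- t - F)) - arcStep (toℕ c)
      ≡⟨ cong (_- arcStep (toℕ c)) bal ⟩
    (φ (toℕ b) - φ (toℕ a)) - arcStep (toℕ c)
      ≡⟨ cong (λ b → (φ (toℕ b) - φ (toℕ a)) - arcStep (toℕ c)) (θ∘θ⁻¹ b) ⟨
    (φ (toℕ (θ c)) - φ (toℕ a)) - arcStep (toℕ c)
      ≡⟨ cong (λ u → (u - φ (toℕ a)) - arcStep (toℕ c)) (φ-θ c) ⟩
    ((φ (toℕ c) + arcStep (toℕ c)) - φ (toℕ a)) - arcStep (toℕ c)
      ≡⟨ ring′ (φ (toℕ c)) (φ (toℕ a)) (arcStep (toℕ c)) ⟩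
    φ (toℕ c) - φ (toℕ a) ∎
    where
    open ≡-Reasoning
    c : Fin m
    c = θ⁻¹ b
    ring : ∀ x y t F f → y * (F - f) - x * (- (1ℤ + t) - (F - f)) ≡ (y * F - x * (- t - F)) - (y * f - x * (1ℤ - f))
    ring = solve-∀
    ring′ : ∀ u v s → ((u + s) - v) - s ≡ u - v
    ring′ = solve-∀

  balanced-start : ∀ a → Balanced a 0ℤ (a , 0ℤ)
  balanced-start a = trans (ring (+ x) (+ y)) (sym (ℤ.+-inverseʳ (φ (toℕ a))))
    where ring : ∀ x y → y * 0ℤ - x * (0ℤ - 0ℤ) ≡ 0ℤ
          ring = solve-∀

  walk-balanced : ∀ t a → Balanced a t (walk t (a , 0ℤ))
  walk-balanced (+ s)    a = applyN-invariant (λ s → Balanced a (+ s)) advance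
                               (balanced-start a) (λ {i} {w} → advance-balanced {a} {+ i} {w}) s
  walk-balanced -[1+ s ] a = applyN-invariant (λ s → Balanced a (- + s)) retreat
                               (balanced-start a) (λ {i} {w} → retreat-balanced {a} {+ i} {w}) (suc s)


  φ-injective-mod : Coprime x y → (b b′ : Fin m) (q : ℤ) → φ (toℕ b) - φ (toℕ b′) ≡ q * + m → b ≡ b′
  φ-injective-mod cop b b′ q φb-φb′≡qm =
    Fin.toℕ-injective (residue-injective (ℕCop.coprime-+ (ℕCop.sym cop)) (Fin.toℕ<n b) (Fin.toℕ<n b′)
      (ℤ∣.∣⇒∣ᵤ {+ m} (ℤ∣.divides ((c - c′) - q) (begin
        + x * (+ toℕ b - + toℕ b′)
          ≡⟨ ring₁ (+ m) (+ x) c c′ (+ toℕ b) (+ toℕ b′) ⟩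
        + m * (c - c′) - ((+ m * c - + x * + toℕ b) - (+ m * c′ - + x * + toℕ b′))
          ≡⟨ cong₂ (λ u v → + m * (c - c′) - (u - v)) (proj₂ (φ-congruence (toℕ b))) (proj₂ (φ-congruence (toℕ b′))) ⟨
        + m * (c - c′) - (φ (toℕ b) - φ (toℕ b′))
          ≡⟨ cong (λ u → + m * (c - c′) - u) φb-φb′≡qm ⟩
        + m * (c - c′) - q * + m
          ≡⟨ ring₂ (+ m) (c - c′) q ⟩
        ((c - c′) - q) * + m ∎))))
    where
    open ≡-Reasoning
    c c′ : ℤ
    c  = proj₁ (φ-congruence (toℕ b))
    c′ = proj₁ (φ-congruence (toℕ b′))
    ring₁ : ∀ m x c c′ b b′ → x * (b - b′) ≡ m * (c - c′) - ((m * c - x * b) - (m * c′ - x * b′))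
    ring₁ = solve-∀
    ring₂ : ∀ m u q → m * u - q * m ≡ (u - q) * m
    ring₂ = solve-∀

  walk-determined : Coprime x y → ∀ {a t w w′} → Balanced a t w → Balanced a t w′ → w ≡ w′
  walk-determined cop {a} {t} {b , F} {b′ , F′} bal bal′ = cong₂ _,_ b≡b′ F≡F′
    where
    open ≡-Reasoning
    m[F-F′]≡φb-φb′ : + m * (F - F′) ≡ φ (toℕ b) - φ (toℕ b′)
    m[F-F′]≡φb-φb′ = begin
      + m * (F - F′)                                              ≡⟨ ring₁ (+ x) (+ y) t F F′ ⟩
      (+ y * F - + x * (t - F)) - (+ y * F′ - + x * (t - F′))     ≡⟨ cong₂ _-_ bal bal′ ⟩
      (φ (toℕ b) - φ (toℕ a)) - (φ (toℕ b′) - φ (toℕ a))          ≡⟨ ring₂ (φ (toℕ b)) (φ (toℕ b′)) (φ (toℕ a)) ⟩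
      φ (toℕ b) - φ (toℕ b′)                                      ∎
      where
      ring₁ : ∀ x y t F F′ → (x + y) * (F - F′) ≡ (y * F - x * (t - F)) - (y * F′ - x * (t - F′))
      ring₁ = solve-∀
      ring₂ : ∀ u u′ v → (u - v) - (u′ - v) ≡ u - u′
      ring₂ = solve-∀
    b≡b′ : b ≡ b′
    b≡b′ = φ-injective-mod cop b b′ (F - F′) (trans (sym m[F-F′]≡φb-φb′) (ℤ.*-comm (+ m) (F - F′)))
    F≡F′ : F ≡ F′
    F≡F′ = ℤ.i-j≡0⇒i≡j F F′ (ℤ.*-cancelˡ-≡ (+ m) _ 0ℤ (begin
      + m * (F - F′)                ≡⟨ m[F-F′]≡φb-φb′ ⟩
      φ (toℕ b) - φ (toℕ b′)        ≡⟨ cong (λ b → φ (toℕ b) - φ (toℕ b′)) b≡b′ ⟩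
      φ (toℕ b′) - φ (toℕ b′)       ≡⟨ ℤ.+-inverseʳ (φ (toℕ b′)) ⟩
      0ℤ                            ≡⟨ ℤ.*-zeroʳ (+ m) ⟨
      + m * 0ℤ                      ∎))

-- The functions g and h

module Graph (x' y' n : ℕ) where

  open Arcs x' y'

  weight : ℕ → ℕ
  weight k = x ^ (n ∸ suc k) ℕ.* y ^ k

  hterm : ℕ → ℕ
  hterm j = x ^ (n ∸ j) ℕ.* y ^ j

  -- h n x y v reduces to + hsum (toℕ v).
  hsum : ℕ → ℕ
  hsum j = sumℕ (map hterm (upTo j))

  hterm-suc : ∀ j → + hterm (suc j) ≡ + weight j * + y
  hterm-suc j = begin
    + (x ^ (n ∸ suc j) ℕ.* (y ℕ.* y ^ j))   ≡⟨ cong +_ (ℕ.*-assoc (x ^ (n ∸ suc j)) y (y ^ j)) ⟨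
    + (x ^ (n ∸ suc j) ℕ.* y ℕ.* y ^ j)     ≡⟨ cong (λ u → + (u ℕ.* y ^ j)) (ℕ.*-comm (x ^ (n ∸ suc j)) y) ⟩
    + (y ℕ.* x ^ (n ∸ suc j) ℕ.* y ^ j)     ≡⟨ cong +_ (ℕ.*-assoc y (x ^ (n ∸ suc j)) (y ^ j)) ⟩
    + (y ℕ.* weight j)                      ≡⟨ ℤ.pos-* y (weight j) ⟩
    + y * + weight j                        ≡⟨ ℤ.*-comm (+ y) (+ weight j) ⟩
    + weight j * + y                        ∎
    where open ≡-Reasoning

  hterm-below : ∀ j → j < n → + hterm j ≡ + weight j * + x
  hterm-below j j<n = begin
    + (x ^ (n ∸ j) ℕ.* y ^ j)                 ≡⟨ cong (λ e → + (x ^ e ℕ.* y ^ j)) (ℕ.+-∸-assoc 1 j<n) ⟩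
    + (x ℕ.* x ^ (n ∸ suc j) ℕ.* y ^ j)       ≡⟨ cong +_ (ℕ.*-assoc x (x ^ (n ∸ suc j)) (y ^ j)) ⟩
    + (x ℕ.* weight j)                        ≡⟨ ℤ.pos-* x (weight j) ⟩
    + x * + weight j                          ≡⟨ ℤ.*-comm (+ x) (+ weight j) ⟩
    + weight j * + x                          ∎
    where open ≡-Reasoning

  h-step : (k : Fin n) (i : ℕ) → h n x y (headℕ x k i) - h n x y (vert k) ≡ + weight (toℕ k) * arcStep i
  h-step k i with i <ᵇ x
  ... | true  = begin
    + hsum (suc (suc (toℕ k))) - + hsum (suc (toℕ (inject₁ k)))
      ≡⟨ cong (λ j → + hsum (suc (suc (toℕ k))) - + hsum (suc j)) (Fin.toℕ-inject₁ k) ⟩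
    + hsum (suc (suc (toℕ k))) - + hsum (suc (toℕ k))
      ≡⟨ cong (λ s → + s - + hsum (suc (toℕ k))) (sumℕ-upTo-suc hterm (suc (toℕ k))) ⟩
    + (hsum (suc (toℕ k)) ℕ.+ hterm (suc (toℕ k))) - + hsum (suc (toℕ k))
      ≡⟨ cong (_- + hsum (suc (toℕ k))) (ℤ.pos-+ (hsum (suc (toℕ k))) _) ⟩
    (+ hsum (suc (toℕ k)) + + hterm (suc (toℕ k))) - + hsum (suc (toℕ k))
      ≡⟨ cong (λ u → (+ hsum (suc (toℕ k)) + u) - + hsum (suc (toℕ k))) (hterm-suc (toℕ k)) ⟩
    (+ hsum (suc (toℕ k)) + + weight (toℕ k) * + y) - + hsum (suc (toℕ k))
      ≡⟨ ring (+ hsum (suc (toℕ k))) (+ weight (toℕ k)) (+ y) (+ x) ⟩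
    + weight (toℕ k) * (+ y * 1ℤ - + x * (1ℤ - 1ℤ)) ∎
    where
    open ≡-Reasoning
    ring : ∀ s w y x → (s + w * y) - s ≡ w * (y * 1ℤ - x * (1ℤ - 1ℤ))
    ring = solve-∀
  ... | false = begin
    + hsum (toℕ (inject₁ (inject₁ k))) - + hsum (suc (toℕ (inject₁ k)))
      ≡⟨ cong₂ (λ j j′ → + hsum j - + hsum (suc j′)) (trans (Fin.toℕ-inject₁ (inject₁ k)) (Fin.toℕ-inject₁ k)) (Fin.toℕ-inject₁ k) ⟩
    + hsum (toℕ k) - + hsum (suc (toℕ k))
      ≡⟨ cong (λ s → + hsum (toℕ k) - + s) (sumℕ-upTo-suc hterm (toℕ k)) ⟩
    + hsum (toℕ k) - + (hsum (toℕ k) ℕ.+ hterm (toℕ k))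
      ≡⟨ cong (λ u → + hsum (toℕ k) - u) (ℤ.pos-+ (hsum (toℕ k)) _) ⟩
    + hsum (toℕ k) - (+ hsum (toℕ k) + + hterm (toℕ k))
      ≡⟨ cong (λ u → + hsum (toℕ k) - (+ hsum (toℕ k) + u)) (hterm-below (toℕ k) (Fin.toℕ<n k)) ⟩
    + hsum (toℕ k) - (+ hsum (toℕ k) + + weight (toℕ k) * + x)
      ≡⟨ ring (+ hsum (toℕ k)) (+ weight (toℕ k)) (+ y) (+ x) ⟩
    + weight (toℕ k) * (+ y * 0ℤ - + x * (1ℤ - 0ℤ)) ∎
    where
    open ≡-Reasoning
    ring : ∀ s w y x → s - (s + w * x) ≡ w * (y * 0ℤ - x * (1ℤ - 0ℤ))
    ring = solve-∀

  gArc-φ : (k : Fin n) (j : Fin m) → gArc x y k j ≡ + weight (toℕ k) * φ (toℕ j)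
  gArc-φ k j = prefix (toℕ j)
    where
    prefix : ∀ j → sumℤ (map (λ i → h n x y (headℕ x k i) - h n x y (vert k)) (upTo j)) ≡ + weight (toℕ k) * φ j
    prefix zero    = sym (ℤ.*-zeroʳ (+ weight (toℕ k)))
    prefix (suc j) = trans (sumℤ-upTo-suc _ j)
      (trans (cong₂ _+_ (prefix j) (h-step k j)) (sym (ℤ.*-distribˡ-+ (+ weight (toℕ k)) (φ j) (arcStep j))))

  g-weightedSum : (ρ : Rotor n x y) → g x y ρ ≡ weightedSum x y n (λ k → φ (toℕ (lookup ρ k)))
  g-weightedSum ρ = trans (cong sumℤ (List.map-cong (λ k → gArc-φ k (lookup ρ k)) (allFin n)))
                          (sym (weightedSum-as-sum x y n _))

  g-sub : (ρ ρ′ : Rotor n x y) →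
          g x y ρ′ - g x y ρ ≡ weightedSum x y n (λ k → φ (toℕ (lookup ρ′ k)) - φ (toℕ (lookup ρ k)))
  g-sub ρ ρ′ = trans (cong₂ _-_ (g-weightedSum ρ′) (g-weightedSum ρ)) (sym (weightedSum-sub x y n _ _))

  gArc-θ : (k : Fin n) (b : Fin m) →
           gArc x y k (θ b) ≡ gArc x y k b + (h n x y (head x y k b) - h n x y (vert k))
  gArc-θ k b = begin
    gArc x y k (θ b)                               ≡⟨ gArc-φ k (θ b) ⟩
    + weight (toℕ k) * φ (toℕ (θ b))               ≡⟨ cong (+ weight (toℕ k) *_) (φ-θ b) ⟩
    + weight (toℕ k) * (φ (toℕ b) + arcStep (toℕ b)) ≡⟨ ℤ.*-distribˡ-+ (+ weight (toℕ k)) _ _ ⟩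
    + weight (toℕ k) * φ (toℕ b) + + weight (toℕ k) * arcStep (toℕ b)
                                                   ≡⟨ cong₂ _+_ (gArc-φ k b) (h-step k (toℕ b)) ⟨
    gArc x y k b + (h n x y (head x y k b) - h n x y (vert k)) ∎
    where open ≡-Reasoning

  g-updateAt : (ρ : Rotor n x y) (k : Fin n) (f : Fin m → Fin m) →
               g x y (updateAt ρ k f) ≡ g x y ρ + (gArc x y k (f (lookup ρ k)) - gArc x y k (lookup ρ k))
  g-updateAt ρ k f =
    trans (sumℤ-update (allFin⁺ n) (∈-allFin k) _ _
                       (λ j j≢k → cong (gArc x y j) (Vec.lookup∘updateAt′ j k j≢k ρ)))
          (cong (λ a → g x y ρ + (gArc x y k a - gArc x y k (lookup ρ k))) (Vec.lookup∘updateAt k ρ))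

  potential : Particles n → ℤ
  potential σ = sumℤ (map (λ v → h n x y v * lookup σ v) (allFin (suc (suc n))))

  potential-addAt : (σ : Particles n) (v : Vertex n) (z : ℤ) → potential (addAt σ v z) ≡ potential σ + h n x y v * z
  potential-addAt σ v z =
    trans (sumℤ-update (allFin⁺ _) (∈-allFin v) _ _
                       (λ w w≢v → cong (h n x y w *_) (Vec.lookup∘updateAt′ w v w≢v σ)))
          (cong (_+_ (potential σ)) (trans (cong (λ s → h n x y v * s - h n x y v * lookup σ v) (Vec.lookup∘updateAt v σ))
                                        (ring (h n x y v) (lookup σ v) z)))
    where ring : ∀ H s z → H * (s + z) - H * s ≡ H * z
          ring = solve-∀

  invariant : Config n x y → ℤ
  invariant (ρ , σ) = g x y ρ - potential σ

  routing⁺-invariant : (k : Fin n) (c : Config n x y) → invariant (routing⁺ x y k c) ≡ invariant c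
  routing⁺-invariant k (ρ , σ) = begin
    g x y (updateAt ρ k θ) - potential (addAt (addAt σ (head x y k a) (+ 1)) (vert k) (- + 1))
      ≡⟨ cong₂ _-_ (g-updateAt ρ k θ)
                   (trans (potential-addAt (addAt σ (head x y k a) (+ 1)) (vert k) (- + 1)) (cong (_+ V * - + 1) (potential-addAt σ (head x y k a) (+ 1)))) ⟩
    (g x y ρ + (gArc x y k (θ a) - gArc x y k a)) - ((potential σ + H * + 1) + V * - + 1)
      ≡⟨ cong (λ u → (g x y ρ + (u - gArc x y k a)) - ((potential σ + H * + 1) + V * - + 1)) (gArc-θ k a) ⟩
    (g x y ρ + ((gArc x y k a + (H - V)) - gArc x y k a)) - ((potential σ + H * + 1) + V * - + 1)
      ≡⟨ ring (g x y ρ) (gArc x y k a) H V (potential σ) ⟩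
    g x y ρ - potential σ ∎
    where
    open ≡-Reasoning
    a : Fin m
    a = lookup ρ k
    H V : ℤ
    H = h n x y (head x y k a)
    V = h n x y (vert k)
    ring : ∀ G A H V P → (G + ((A + (H - V)) - A)) - ((P + H * 1ℤ) + V * - 1ℤ) ≡ G - P
    ring = solve-∀

  routing⁻-invariant : (k : Fin n) (c : Config n x y) → invariant (routing⁻ x y k c) ≡ invariant c
  routing⁻-invariant k (ρ , σ) = begin
    g x y (updateAt ρ k θ⁻¹) - potential (addAt (addAt σ (head x y k b) (- + 1)) (vert k) (+ 1))
      ≡⟨ cong₂ _-_ (g-updateAt ρ k θ⁻¹)
                   (trans (potential-addAt (addAt σ (head x y k b) (- + 1)) (vert k) (+ 1)) (cong (_+ V * + 1) (potential-addAt σ (head x y k b) (- + 1)))) ⟩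
    (g x y ρ + (gArc x y k b - gArc x y k a)) - ((potential σ + H * - + 1) + V * + 1)
      ≡⟨ cong (λ a → (g x y ρ + (gArc x y k b - gArc x y k a)) - ((potential σ + H * - + 1) + V * + 1)) (θ∘θ⁻¹ a) ⟨
    (g x y ρ + (gArc x y k b - gArc x y k (θ b))) - ((potential σ + H * - + 1) + V * + 1)
      ≡⟨ cong (λ u → (g x y ρ + (gArc x y k b - u)) - ((potential σ + H * - + 1) + V * + 1)) (gArc-θ k b) ⟩
    (g x y ρ + (gArc x y k b - (gArc x y k b + (H - V)))) - ((potential σ + H * - + 1) + V * + 1)
      ≡⟨ ring (g x y ρ) (gArc x y k b) H V (potential σ) ⟩
    g x y ρ - potential σ ∎
    where
    open ≡-Reasoning
    a b : Fin m
    a = lookup ρ k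
    b = θ⁻¹ a
    H V : ℤ
    H = h n x y (head x y k b)
    V = h n x y (vert k)
    ring : ∀ G B H V P → (G + (B - (B + (H - V)))) - ((P + H * - 1ℤ) + V * 1ℤ) ≡ G - P
    ring = solve-∀

  routing-invariant : (r : Fin n → ℤ) (c : Config n x y) → invariant (routing x y r c) ≡ invariant c
  routing-invariant r c = along (allFin n)
    where
    iterate : ∀ f → (∀ c → invariant (f c) ≡ invariant c) → ∀ s c → invariant (applyN s f c) ≡ invariant c
    iterate f f-invariant s c =
      applyN-invariant (λ _ c′ → invariant c′ ≡ invariant c) f refl (trans (f-invariant _)) s
    routingPow-invariant : ∀ k t c → invariant (routingPow x y k t c) ≡ invariant c
    routingPow-invariant k (+ s)    = iterate (routing⁺ x y k) (routing⁺-invariant k) s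
    routingPow-invariant k -[1+ s ] = iterate (routing⁻ x y k) (routing⁻-invariant k) (suc s)
    along : ∀ ks → invariant (foldr (λ k c′ → routingPow x y k (r k) c′) c ks) ≡ invariant c
    along []       = refl
    along (k ∷ ks) = trans (routingPow-invariant k (r k) _) (along ks)

  equivalent⇒g-equal : (ρ ρ′ : Rotor n x y) → RotorEquiv x y ρ ρ′ → g x y ρ ≡ g x y ρ′
  equivalent⇒g-equal ρ ρ′ (σ , r , routed) =
    sym (∙-cancelʳ (- potential σ) (g x y ρ′) (g x y ρ) (trans (cong invariant (sym routed)) (routing-invariant r (ρ , σ))))

  -- Routing every vertex

  δ-head : (k : Fin n) (b : Fin m) (w : ℕ) →
           δ (toℕ (head x y k b)) w ≡ forward (toℕ b) * δ (2 ℕ.+ toℕ k) w + (1ℤ - forward (toℕ b)) * δ (toℕ k) w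
  δ-head k b w with toℕ b <ᵇ x
  ... | true  = ring (δ (2 ℕ.+ toℕ k) w) (δ (toℕ k) w)
    where ring : ∀ d₂ d₀ → d₂ ≡ 1ℤ * d₂ + (1ℤ - 1ℤ) * d₀
          ring = solve-∀
  ... | false = trans (cong (λ j → δ j w) (trans (Fin.toℕ-inject₁ (inject₁ k)) (Fin.toℕ-inject₁ k)))
                      (ring (δ (2 ℕ.+ toℕ k) w) (δ (toℕ k) w))
    where ring : ∀ d₂ d₀ → d₀ ≡ 0ℤ * d₂ + (1ℤ - 0ℤ) * d₀
          ring = solve-∀

  lookup-route : (σ : Particles n) (k : Fin n) (b : Fin m) (z : ℤ) (v : Vertex n) →
    lookup (addAt (addAt σ (head x y k b) z) (vert k) (- z)) v ≡
    lookup σ v + transfer (toℕ k) (z * forward (toℕ b)) (z * (1ℤ - forward (toℕ b))) (toℕ v)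
  lookup-route σ k b z v = begin
    lookup (addAt (addAt σ (head x y k b) z) (vert k) (- z)) v
      ≡⟨ lookup-addAt (addAt σ (head x y k b) z) (vert k) v (- z) ⟩
    lookup (addAt σ (head x y k b) z) v + - z * δ (suc (toℕ (inject₁ k))) (toℕ v)
      ≡⟨ cong₂ (λ s j → s + - z * δ (suc j) (toℕ v)) (lookup-addAt σ (head x y k b) v z) (Fin.toℕ-inject₁ k) ⟩
    (lookup σ v + z * δ (toℕ (head x y k b)) (toℕ v)) + - z * δ (suc (toℕ k)) (toℕ v)
      ≡⟨ cong (λ d → (lookup σ v + z * d) + - z * δ (suc (toℕ k)) (toℕ v)) (δ-head k b (toℕ v)) ⟩
    (lookup σ v + z * (f * δ (2 ℕ.+ toℕ k) (toℕ v) + (1ℤ - f) * δ (toℕ k) (toℕ v))) + - z * δ (suc (toℕ k)) (toℕ v)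
      ≡⟨ ring (lookup σ v) z f (δ (2 ℕ.+ toℕ k) (toℕ v)) (δ (toℕ k) (toℕ v)) (δ (suc (toℕ k)) (toℕ v)) ⟩
    lookup σ v + transfer (toℕ k) (z * f) (z * (1ℤ - f)) (toℕ v) ∎
    where
    open ≡-Reasoning
    f = forward (toℕ b)
    ring : ∀ s z f d₂ d₀ d₁ → (s + z * (f * d₂ + (1ℤ - f) * d₀)) + - z * d₁ ≡
                               s + ((z * f) * d₂ + (z * (1ℤ - f)) * d₀ - (z * f + z * (1ℤ - f)) * d₁)
    ring = solve-∀

  -- c′ arises from c by routing the rotor at k t times, w being the walk of that rotor.
  record Tracks (k : Fin n) (c : Config n x y) (t : ℤ) (w : Walk) (c′ : Config n x y) : Set where
    field
      rotor-at : lookup (proj₁ c′) k ≡ proj₁ w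
      rotor-elsewhere : ∀ j → j ≢ k → lookup (proj₁ c′) j ≡ lookup (proj₁ c) j
      particles : ∀ v → lookup (proj₂ c′) v ≡ lookup (proj₂ c) v + transfer (toℕ k) (proj₂ w) (t - proj₂ w) (toℕ v)

  tracks-start : ∀ k c → Tracks k c 0ℤ (lookup (proj₁ c) k , 0ℤ) c
  tracks-start k c = record
    { rotor-at        = refl
    ; rotor-elsewhere = λ _ _ → refl
    ; particles       = λ v → sym (trans (cong (_+_ (lookup (proj₂ c) v)) (ring (δ (2 ℕ.+ toℕ k) (toℕ v)) (δ (toℕ k) (toℕ v)) (δ (1 ℕ.+ toℕ k) (toℕ v))))
                                         (ℤ.+-identityʳ _))
    }
    where ring : ∀ d₂ d₀ d₁ → 0ℤ * d₂ + (0ℤ - 0ℤ) * d₀ - (0ℤ + (0ℤ - 0ℤ)) * d₁ ≡ 0ℤ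
          ring = solve-∀

  tracks-advance : ∀ {k c} t w ρ′ σ′ → Tracks k c t w (ρ′ , σ′) →
                   Tracks k c (1ℤ + t) (advance w) (routing⁺ x y k (ρ′ , σ′))
  tracks-advance {k} {c} t (b , F) ρ′ σ′ tr = record
    { rotor-at        = trans (Vec.lookup∘updateAt k ρ′) (cong θ rotor-at)
    ; rotor-elsewhere = λ j j≢k → trans (Vec.lookup∘updateAt′ j k j≢k ρ′) (rotor-elsewhere j j≢k)
    ; particles       = λ v → begin
        lookup (addAt (addAt σ′ (head x y k (lookup ρ′ k)) (+ 1)) (vert k) (- + 1)) v
          ≡⟨ lookup-route σ′ k (lookup ρ′ k) (+ 1) v ⟩
        lookup σ′ v + transfer (toℕ k) (+ 1 * f (lookup ρ′ k)) (+ 1 * (1ℤ - f (lookup ρ′ k))) (toℕ v)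
          ≡⟨ cong₂ (λ s a → s + transfer (toℕ k) (+ 1 * f a) (+ 1 * (1ℤ - f a)) (toℕ v)) (particles v) rotor-at ⟩
        (lookup (proj₂ c) v + transfer (toℕ k) F (t - F) (toℕ v)) + transfer (toℕ k) (+ 1 * f b) (+ 1 * (1ℤ - f b)) (toℕ v)
          ≡⟨ ℤ.+-assoc (lookup (proj₂ c) v) _ _ ⟩
        lookup (proj₂ c) v + (transfer (toℕ k) F (t - F) (toℕ v) + transfer (toℕ k) (+ 1 * f b) (+ 1 * (1ℤ - f b)) (toℕ v))
          ≡⟨ cong (_+_ (lookup (proj₂ c) v)) (transfer-+ (toℕ k) F (t - F) _ _ (toℕ v)) ⟩
        lookup (proj₂ c) v + transfer (toℕ k) (F + + 1 * f b) ((t - F) + + 1 * (1ℤ - f b)) (toℕ v)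
          ≡⟨ cong₂ (λ F′ B′ → lookup (proj₂ c) v + transfer (toℕ k) F′ B′ (toℕ v)) (ring₁ F (f b)) (ring₂ t F (f b)) ⟩
        lookup (proj₂ c) v + transfer (toℕ k) (F + f b) ((1ℤ + t) - (F + f b)) (toℕ v) ∎
    }
    where
    open Tracks tr
    open ≡-Reasoning
    f : Fin m → ℤ
    f a = forward (toℕ a)
    ring₁ : ∀ F f → F + 1ℤ * f ≡ F + f
    ring₁ = solve-∀
    ring₂ : ∀ t F f → (t - F) + 1ℤ * (1ℤ - f) ≡ (1ℤ + t) - (F + f)
    ring₂ = solve-∀

  tracks-retreat : ∀ {k c} t w ρ′ σ′ → Tracks k c (- t) w (ρ′ , σ′) →
                   Tracks k c (- (1ℤ + t)) (retreat w) (routing⁻ x y k (ρ′ , σ′))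
  tracks-retreat {k} {c} t (b , F) ρ′ σ′ tr = record
    { rotor-at        = trans (Vec.lookup∘updateAt k ρ′) (cong θ⁻¹ rotor-at)
    ; rotor-elsewhere = λ j j≢k → trans (Vec.lookup∘updateAt′ j k j≢k ρ′) (rotor-elsewhere j j≢k)
    ; particles       = λ v → begin
        lookup (addAt (addAt σ′ (head x y k (θ⁻¹ (lookup ρ′ k))) (- + 1)) (vert k) (+ 1)) v
          ≡⟨ lookup-route σ′ k (θ⁻¹ (lookup ρ′ k)) (- + 1) v ⟩
        lookup σ′ v + transfer (toℕ k) (- + 1 * f (lookup ρ′ k)) (- + 1 * (1ℤ - f (lookup ρ′ k))) (toℕ v)
          ≡⟨ cong₂ (λ s a → s + transfer (toℕ k) (- + 1 * f a) (- + 1 * (1ℤ - f a)) (toℕ v)) (particles v) rotor-at ⟩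
        (lookup (proj₂ c) v + transfer (toℕ k) F (- t - F) (toℕ v)) + transfer (toℕ k) (- + 1 * f b) (- + 1 * (1ℤ - f b)) (toℕ v)
          ≡⟨ ℤ.+-assoc (lookup (proj₂ c) v) _ _ ⟩
        lookup (proj₂ c) v + (transfer (toℕ k) F (- t - F) (toℕ v) + transfer (toℕ k) (- + 1 * f b) (- + 1 * (1ℤ - f b)) (toℕ v))
          ≡⟨ cong (_+_ (lookup (proj₂ c) v)) (transfer-+ (toℕ k) F (- t - F) _ _ (toℕ v)) ⟩
        lookup (proj₂ c) v + transfer (toℕ k) (F + - + 1 * f b) ((- t - F) + - + 1 * (1ℤ - f b)) (toℕ v)
          ≡⟨ cong₂ (λ F′ B′ → lookup (proj₂ c) v + transfer (toℕ k) F′ B′ (toℕ v)) (ring₁ F (f b)) (ring₂ t F (f b)) ⟩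
        lookup (proj₂ c) v + transfer (toℕ k) (F - f b) (- (1ℤ + t) - (F - f b)) (toℕ v) ∎
    }
    where
    open Tracks tr
    open ≡-Reasoning
    f : Fin m → ℤ
    f a = forward (toℕ (θ⁻¹ a))
    ring₁ : ∀ F f → F + - 1ℤ * f ≡ F - f
    ring₁ = solve-∀
    ring₂ : ∀ t F f → (- t - F) + - 1ℤ * (1ℤ - f) ≡ - (1ℤ + t) - (F - f)
    ring₂ = solve-∀

  routingPow-tracks : ∀ k t c → Tracks k c t (walk t (lookup (proj₁ c) k , 0ℤ)) (routingPow x y k t c)
  routingPow-tracks k (+ s) c =
    applyN-invariant (λ i w → Tracks k c (+ i) w (applyN i (routing⁺ x y k) c)) advance
      (tracks-start k c) (λ {i} {w} → tracks-advance (+ i) w _ _) s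
  routingPow-tracks k -[1+ s ] c =
    applyN-invariant (λ i w → Tracks k c (- + i) w (applyN i (routing⁻ x y k) c)) retreat
      (tracks-start k c) (λ {i} {w} → tracks-retreat (+ i) w _ _) (suc s)

  module _ (r : Fin n → ℤ) (c : Config n x y) where

    routeAll : List (Fin n) → Config n x y
    routeAll = foldr (λ k c′ → routingPow x y k (r k) c′) c

    endpoint : Fin n → Walk
    endpoint k = walk (r k) (lookup (proj₁ c) k , 0ℤ)

    routeAll-outside : ∀ ks {k} → k ∉ ks → lookup (proj₁ (routeAll ks)) k ≡ lookup (proj₁ c) k
    routeAll-outside []       k∉ = refl
    routeAll-outside (j ∷ ks) k∉ =
      trans (Tracks.rotor-elsewhere (routingPow-tracks j (r j) (routeAll ks)) _ (k∉ ∘ here))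
            (routeAll-outside ks (k∉ ∘ there))

    routeAll-step : ∀ {j ks} → j ∉ ks → Tracks j (routeAll ks) (r j) (endpoint j) (routeAll (j ∷ ks))
    routeAll-step {j} {ks} j∉ks =
      subst (λ a → Tracks j (routeAll ks) (r j) (walk (r j) (a , 0ℤ)) (routeAll (j ∷ ks)))
            (routeAll-outside ks j∉ks) (routingPow-tracks j (r j) (routeAll ks))

    routeAll-inside : ∀ {ks} → Unique ks → ∀ {k} → k ∈ ks → lookup (proj₁ (routeAll ks)) k ≡ proj₁ (endpoint k)
    routeAll-inside (j∉ks ∷ _) (here refl) = Tracks.rotor-at (routeAll-step (All¬⇒¬Any j∉ks))
    routeAll-inside {j ∷ ks} (j∉ks ∷ uniq) (there k∈ks) =
      trans (Tracks.rotor-elsewhere (routeAll-step (All¬⇒¬Any j∉ks)) _ (λ k≡j → All.lookup j∉ks k∈ks (sym k≡j)))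
            (routeAll-inside uniq k∈ks)

    routeAll-particles : ∀ {ks} → Unique ks → ∀ v →
      lookup (proj₂ (routeAll ks)) v ≡
      lookup (proj₂ c) v + sumℤ (map (λ k → transfer (toℕ k) (proj₂ (endpoint k)) (r k - proj₂ (endpoint k)) (toℕ v)) ks)
    routeAll-particles []             v = sym (ℤ.+-identityʳ _)
    routeAll-particles (j∉ks ∷ uniq) v =
      trans (Tracks.particles (routeAll-step (All¬⇒¬Any j∉ks)) v)
            (trans (cong (_+ _) (routeAll-particles uniq v)) (ring (lookup (proj₂ c) v) _ _))
      where ring : ∀ s S T → (s + S) + T ≡ s + (T + S)
            ring = solve-∀

  g-equal⇒equivalent : Coprime x y → (ρ ρ′ : Rotor n x y) → g x y ρ ≡ g x y ρ′ → RotorEquiv x y ρ ρ′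
  g-equal⇒equivalent cop ρ ρ′ g≡g′ =
    σ , r , cong₂ _,_ (Pointwise-≡⇒≡ (ext rotors-match)) (Pointwise-≡⇒≡ (ext particles-return))
    where
    open ≡-Reasoning
    D : Fin n → ℤ
    D k = φ (toℕ (lookup ρ′ k)) - φ (toℕ (lookup ρ k))
    solvable : + (x ^ n) * 0ℤ + weightedSum x y n D ≡ 0ℤ
    solvable = begin
      + (x ^ n) * 0ℤ + weightedSum x y n D ≡⟨ cong (_+ weightedSum x y n D) (ℤ.*-zeroʳ (+ (x ^ n))) ⟩
      0ℤ + weightedSum x y n D             ≡⟨ ℤ.+-identityˡ _ ⟩
      weightedSum x y n D                  ≡⟨ g-sub ρ ρ′ ⟨
      g x y ρ′ - g x y ρ                   ≡⟨ cong (_- g x y ρ) g≡g′ ⟨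
      g x y ρ - g x y ρ                    ≡⟨ ℤ.+-inverseʳ (g x y ρ) ⟩
      0ℤ                                   ∎
    solution : RecurrenceSolution x y n D 0ℤ
    solution = solve-recurrence cop n D 0ℤ solvable
    e : ℕ → ℤ
    e = proj₁ solution
    r : Fin n → ℤ
    r k = e (suc (toℕ k)) + e (toℕ k)
    σ : Particles n
    σ = replicate _ 0ℤ
    r-e₁≡e₀ : ∀ k → r k - e (suc (toℕ k)) ≡ e (toℕ k)
    r-e₁≡e₀ k = ring (e (suc (toℕ k))) (e (toℕ k))
      where ring : ∀ e₁ e₀ → (e₁ + e₀) - e₁ ≡ e₀
            ring = solve-∀
    endpoint≡ : ∀ k → endpoint r (ρ , σ) k ≡ (lookup ρ′ k , e (suc (toℕ k)))
    endpoint≡ k = walk-determined cop {lookup ρ k} {r k} (walk-balanced (r k) (lookup ρ k))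
      (trans (cong (λ u → + y * e (suc (toℕ k)) - + x * u) (r-e₁≡e₀ k)) (proj₂ (proj₂ (proj₂ solution)) k))
    rotors-match : ∀ k → lookup (proj₁ (routing x y r (ρ , σ))) k ≡ lookup ρ′ k
    rotors-match k = trans (routeAll-inside r (ρ , σ) (allFin⁺ n) (∈-allFin k)) (cong proj₁ (endpoint≡ k))
    particles-return : ∀ v → lookup (proj₂ (routing x y r (ρ , σ))) v ≡ lookup σ v
    particles-return v = begin
      lookup (proj₂ (routing x y r (ρ , σ))) v
        ≡⟨ routeAll-particles r (ρ , σ) (allFin⁺ n) v ⟩
      lookup σ v + sumℤ (map (λ k → transfer (toℕ k) (F k) (r k - F k) (toℕ v)) (allFin n))
        ≡⟨ cong (λ s → lookup σ v + sumℤ s) (List.map-cong (λ k → cong (λ F → transfer (toℕ k) F (r k - F) (toℕ v)) (cong proj₂ (endpoint≡ k))) (allFin n)) ⟩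
      lookup σ v + sumℤ (map (λ k → transfer (toℕ k) (e (suc (toℕ k))) (r k - e (suc (toℕ k))) (toℕ v)) (allFin n))
        ≡⟨ cong (λ s → lookup σ v + sumℤ s) (List.map-cong (λ k → cong (λ B → transfer (toℕ k) (e (suc (toℕ k))) B (toℕ v)) (r-e₁≡e₀ k)) (allFin n)) ⟩
      lookup σ v + sumℤ (map (λ k → transfer (toℕ k) (e (suc (toℕ k))) (e (toℕ k)) (toℕ v)) (allFin n))
        ≡⟨ cong (_+_ (lookup σ v)) (transfers-telescope n e (proj₁ (proj₂ solution)) (proj₁ (proj₂ (proj₂ solution))) (toℕ v)) ⟩
      lookup σ v + 0ℤ
        ≡⟨ ℤ.+-identityʳ (lookup σ v) ⟩
      lookup σ v ∎
      where F : Fin n → ℤ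
            F k = proj₂ (endpoint r (ρ , σ) k)

proposition9 : (n x y : ℕ) → 1 ≤ n → Coprime x y → 1 ≤ x → x < y →
                 (ρ ρ' : Rotor n x y) → RotorEquiv x y ρ ρ' ⇔ (g x y ρ ≡ g x y ρ')
proposition9 n zero     y        _ _   ()  _  ρ ρ'
proposition9 n (suc x') zero     _ _   _   () ρ ρ'
proposition9 n (suc x') (suc y') _ cop _   _  ρ ρ' =
  mk⇔ (equivalent⇒g-equal ρ ρ') (g-equal⇒equivalent cop ρ ρ')
  where open Graph x' y' n
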